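{- Let $B^{\rm WA}(x,y)=\sum_G x^{\#H(G)}y^{\#U(G)}$, the sum over all weakly alternating bargraphs $G$. Then $$B^{\rm WA}=\frac{1-2x-y+2xy+x^2-\sqrt{\bigl((1-x)^2-y\bigr)\bigl((1-x)^2-y(1-2x)^2\bigr)}}{2x(1-x)}.$$
   Context: A bargraph is a lattice path with steps $U=(0,1)$, $H=(1,0)$, $D=(0,-1)$, identified with its word over $\{U,H,D\}$, that starts at the origin, ends on the $x$-axis, stays strictly above the $x$-axis except at its endpoints, and contains no two consecutive steps $UD$ or $DU$ (the empty path is not a bargraph). $\#H(G)$, $\#U(G)$ denote the numbers of $H$ and $U$ steps. A bargraph is weakly alternating if it has the form $U^{i_1}H^{j_1}D^{k_1}H^{\ell_1}U^{i_2}H^{j_2}D^{k_2}H^{\ell_2}\cdots U^{i_m}H^{j_m}D^{k_m}$ for some $m\ge1$ and positive integers $i_r,j_r,k_r,\ell_r$ (i.e. its ascents and descents alternate). -}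

module Defs where

open import Data.Bool using (Bool; true; false; _∧_; if_then_else_)
open import Data.Nat as ℕ using (ℕ; zero; suc)
open import Data.Integer as ℤ using (ℤ; +_; _-_; _<?_)
open import Data.List using (List; []; _∷_; length; filter; map; concatMap; foldr; upTo; all)
open import Relation.Nullary using (does)
open import Relation.Nullary.Decidable using (yes; no)
open import Relation.Binary.PropositionalEquality using (_≡_)

data Step : Set where
  U H D : Step

words : ℕ → List (List Step)
words zero    = [] ∷ []
words (suc L) = concatMap (λ w → (U ∷ w) ∷ (H ∷ w) ∷ (D ∷ w) ∷ []) (words L)

count : Step → List Step → ℕ
count s []       = zero
count s (t ∷ ts) = countStep s t ℕ.+ count s ts
  where
  countStep : Step → Step → ℕ
  countStep U U = 1
  countStep H H = 1
  countStep D D = 1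
  countStep _ _ = 0

#H #U : List Step → ℕ
#H = count H
#U = count U

dy : Step → ℤ
dy U = + 1
dy H = + 0
dy D = ℤ.- (+ 1)

heightsAfter : ℤ → List Step → List ℤ
heightsAfter h []       = []
heightsAfter h (s ∷ ss) = (h ℤ.+ dy s) ∷ heightsAfter (h ℤ.+ dy s) ss

interiorPosEndZero : List ℤ → Bool
interiorPosEndZero []           = false
interiorPosEndZero (h ∷ [])     = does (h ℤ.≟ + 0)
interiorPosEndZero (h ∷ h' ∷ t) = does (+ 0 <? h) ∧ interiorPosEndZero (h' ∷ t)

noUDDU : List Step → Bool
noUDDU []           = true
noUDDU (U ∷ D ∷ _)  = false
noUDDU (D ∷ U ∷ _)  = false
noUDDU (_ ∷ t)      = noUDDU t

-- G is a bargraph: nonempty, starts at the origin, ends on the x-axis,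
-- strictly above the x-axis except at its endpoints, no UD / DU.
-- (nonemptiness is enforced by interiorPosEndZero [] = false)
isBargraph : List Step → Bool
isBargraph w = interiorPosEndZero (heightsAfter (+ 0) w) ∧ noUDDU w

-- Weakly alternating:  U^{i1} H^{j1} D^{k1} H^{l1} ... U^{im} H^{jm} D^{km}
-- with all exponents positive, m ≥ 1.  Equivalently the sequence of letters
-- of the maximal runs of w is  U H D (H U H D)^{m-1}.

stepEq : Step → Step → Bool
stepEq U U = true
stepEq H H = true
stepEq D D = true
stepEq _ _ = false

runLetters : List Step → List Step
runLetters []       = []
runLetters (s ∷ ss) = go s ss
  where
  go : Step → List Step → List Step
  go c []       = c ∷ []
  go c (t ∷ ts) = if stepEq c t then go c ts else c ∷ go t ts

patWA : List Step → Bool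
patWA (U ∷ H ∷ D ∷ rest) = patTail rest
  where
  patTail : List Step → Bool
  patTail []                     = true
  patTail (H ∷ U ∷ H ∷ D ∷ rest) = patTail rest
  patTail _                      = false
patWA _ = false

isWeaklyAlternating : List Step → Bool
isWeaklyAlternating w = patWA (runLetters w)

-- Formal power series in x, y with integer coefficients:
-- S n k = coefficient of x^n y^k.

PS : Set
PS = ℕ → ℕ → ℤ

sumℤ : List ℤ → ℤ
sumℤ = foldr ℤ._+_ (+ 0)

_+ₛ_ _-ₛ_ _*ₛ_ : PS → PS → PS
(f +ₛ g) n k = f n k ℤ.+ g n k
(f -ₛ g) n k = f n k - g n k
(f *ₛ g) n k =
  sumℤ (map (λ a → sumℤ (map (λ b → f a b ℤ.* g (n ℕ.∸ a) (k ℕ.∸ b)) (upTo (suc k))))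
            (upTo (suc n)))

infixl 6 _+ₛ_ _-ₛ_
infixl 7 _*ₛ_

cₛ : ℤ → PS
cₛ c zero zero = c
cₛ c _    _    = + 0

Xₛ Yₛ : PS
Xₛ 1 0 = + 1
Xₛ _ _ = + 0
Yₛ 0 1 = + 1
Yₛ _ _ = + 0

-- Any bargraph ends at height 0, so #D = #U and
-- its length is #H + 2 #U; hence it suffices to search words of length n+2k.

isWAB : ℕ → ℕ → List Step → Bool
isWAB n k w = isBargraph w ∧ isWeaklyAlternating w
            ∧ (#H w ℕ.≡ᵇ n) ∧ (#U w ℕ.≡ᵇ k)

BWA : PS
BWA n k = + length (filter (λ w → isWAB n k w Data.Bool.≟ true) (words (n ℕ.+ 2 ℕ.* k)))
  where import Data.Bool

Pnum : PS
Pnum = cₛ (+ 1) -ₛ cₛ (+ 2) *ₛ Xₛ -ₛ Yₛ +ₛ cₛ (+ 2) *ₛ Xₛ *ₛ Yₛ +ₛ Xₛ *ₛ Xₛ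

Qrad : PS
Qrad = ((oneMinusX *ₛ oneMinusX) -ₛ Yₛ)
       *ₛ ((oneMinusX *ₛ oneMinusX) -ₛ Yₛ *ₛ (oneMinus2X *ₛ oneMinus2X))
  where
  oneMinusX  = cₛ (+ 1) -ₛ Xₛ
  oneMinus2X = cₛ (+ 1) -ₛ cₛ (+ 2) *ₛ Xₛ

Den : PS
Den = cₛ (+ 2) *ₛ Xₛ *ₛ (cₛ (+ 1) -ₛ Xₛ)

module Submission where

open import Defs
open import Data.Nat using (ℕ)
open import Data.Integer using (ℤ; +_)
open import Data.Product using (Σ; _×_)
open import Relation.Binary.PropositionalEquality using (_≡_)

open import Algebra.Bundles using (CommutativeRing)
open import Algebra.Solver.Ring.AlmostCommutativeRing using (_-Raw-AlmostCommutative⟶_; fromCommutativeRing)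
open import Algebra.Structures using (IsAbelianGroup; IsCommutativeRing)
open import Data.Bool as Bool using (Bool; true; false; _∧_; if_then_else_)
open import Data.Bool.Properties using (∧-assoc; ∧-zeroʳ)
open import Data.Fin using (Fin; zero; suc; toℕ)
open import Data.Fin.Properties using (toℕ≤pred[n])
open import Data.Integer as ℤ using (_<?_)
import Data.Integer.Properties as ℤP
import Data.Integer.Tactic.RingSolver as ℤ-Solver
open import Data.List using (List; []; _∷_; length; filter; map; upTo; applyUpTo; concatMap)
open import Data.List.Properties using (map-applyUpTo)
open import Data.Maybe using (Maybe; just; nothing)
open import Data.Nat as ℕ using (zero; suc; _∸_; _<_; s≤s)
import Data.Nat.Properties as ℕ
open import Data.Nat.Tactic.RingSolver using (solve-∀)
open import Data.Product using (∃; _,_)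
open import Function using (_∘_)
open import Relation.Binary.Structures using (IsEquivalence)
open import Relation.Nullary using (does; yes; no)
import Relation.Binary.PropositionalEquality as ≡

-- A weakly alternating bargraph is a word accepted by an automaton whose states record the last
-- step (U, an H after an ascent, D, an H after a descent) and the height.  The generating series
-- u h, p h, d h, v h of the words leading from these states at height h back to the axis satisfy
-- linear recurrences in h with d 0 = 1, and B^WA = y u 0.  The factorisations u h = u 0 d h,
-- p h = p 0 d h, d (h+1) = d 1 d h and v h = v 0 d h hold because their errors satisfy homogeneous
-- recurrences in which every term carries a factor x or y, so they vanish by induction on the total
-- degree.  With u 1 = u 0 d 1 the recurrences at h = 0 become two polynomial equations in u 0 and
-- d 1; eliminating d 1 shows that B = B^WA satisfies x(1-x)(B^2 + y) = P B for the numerator P.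
-- Hence (P - 2x(1-x)B)^2 = P^2 - 4x^2(1-x)^2 y, which is the radicand.

module CauchyProduct {c ℓ} (R : CommutativeRing c ℓ) where

  open CommutativeRing R
  open import Algebra.Properties.Semiring.Sum semiring
    using (sum; sum-cong-≋; ∑-distrib-+; *-distribˡ-sum; sum-replicate-zero)
  open import Algebra.Properties.CommutativeSemigroup +-commutativeSemigroup
    using (x∙yz≈y∙xz)
  open import Relation.Binary.Reasoning.Setoid setoid

  Seq : Set c
  Seq = ℕ → Carrier

  infix 4 _≋_
  _≋_ : Seq → Seq → Set ℓ
  F ≋ G = ∀ n → F n ≈ G n

  infixl 6 _⊕_
  infixl 7 _⋆_

  _⊕_ : Seq → Seq → Seq
  (F ⊕ G) n = F n + G n

  ⊖_ : Seq → Seq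
  (⊖ F) n = - F n

  𝟘 : Seq
  𝟘 _ = 0#

  ι : Carrier → Seq
  ι a zero    = a
  ι a (suc _) = 0#

  𝟙 : Seq
  𝟙 = ι 1#

  𝕩 : Seq
  𝕩 (suc zero) = 1#
  𝕩 _          = 0#

  _⋆_ : Seq → Seq → Seq
  (F ⋆ G) n = sum {suc n} (λ i → F (toℕ i) * G (n ∸ toℕ i))

  ⋆-cong : ∀ {F F′ G G′} → F ≋ F′ → G ≋ G′ → F ⋆ G ≋ F′ ⋆ G′
  ⋆-cong F≋F′ G≋G′ n = sum-cong-≋ {suc n} (λ i → *-cong (F≋F′ (toℕ i)) (G≋G′ (n ∸ toℕ i)))

  ⋆-zeroˡ : ∀ G → 𝟘 ⋆ G ≋ 𝟘
  ⋆-zeroˡ G n = trans (sum-cong-≋ {suc n} (λ i → zeroˡ (G (n ∸ toℕ i)))) (sum-replicate-zero (suc n))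

  ⋆-distribʳ : ∀ F G K → (F ⊕ G) ⋆ K ≋ F ⋆ K ⊕ G ⋆ K
  ⋆-distribʳ F G K n = trans (sum-cong-≋ {suc n} (λ i → distribʳ (K (n ∸ toℕ i)) (F (toℕ i)) (G (toℕ i))))
                             (∑-distrib-+ {suc n} (λ i → F (toℕ i) * K (n ∸ toℕ i)) (λ i → G (toℕ i) * K (n ∸ toℕ i)))

  ⋆-scaleˡ : ∀ a F G → (λ i → a * F i) ⋆ G ≋ (λ n → a * (F ⋆ G) n)
  ⋆-scaleˡ a F G n = trans (sum-cong-≋ {suc n} (λ i → *-assoc a (F (toℕ i)) (G (n ∸ toℕ i))))
                           (sym (*-distribˡ-sum {suc n} a (λ i → F (toℕ i) * G (n ∸ toℕ i))))

  ι-⋆ : ∀ a F → ι a ⋆ F ≋ (λ n → a * F n)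
  ι-⋆ a F zero    = +-identityʳ _
  ι-⋆ a F (suc n) = trans (+-congˡ (⋆-zeroˡ F n)) (+-identityʳ _)

  𝕩-⋆-zero : ∀ F → (𝕩 ⋆ F) 0 ≈ 0#
  𝕩-⋆-zero F = trans (+-identityʳ _) (zeroˡ _)

  𝕩-⋆-suc : ∀ F n → (𝕩 ⋆ F) (suc n) ≈ F n
  𝕩-⋆-suc F n = begin
    0# * F (suc n) + ((𝕩 ∘ suc) ⋆ F) n  ≈⟨ +-cong (zeroˡ _) (⋆-cong {G = F} 𝕩∘suc≋𝟙 (λ _ → refl) n) ⟩
    0# + (𝟙 ⋆ F) n                     ≈⟨ +-identityˡ _ ⟩
    (𝟙 ⋆ F) n                          ≈⟨ ι-⋆ 1# F n ⟩
    1# * F n                           ≈⟨ *-identityˡ _ ⟩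
    F n                                ∎
    where
    𝕩∘suc≋𝟙 : 𝕩 ∘ suc ≋ 𝟙
    𝕩∘suc≋𝟙 zero    = refl
    𝕩∘suc≋𝟙 (suc _) = refl

  ⋆-comm : ∀ F G → F ⋆ G ≋ G ⋆ F
  ⋆-comm F G zero             = +-congʳ (*-comm (F 0) (G 0))
  ⋆-comm F G (suc zero)       = begin
    F 0 * G 1 + (F 1 * G 0 + 0#)  ≈⟨ +-congˡ (+-identityʳ _) ⟩
    F 0 * G 1 + F 1 * G 0         ≈⟨ +-comm _ _ ⟩
    F 1 * G 0 + F 0 * G 1         ≈⟨ +-cong (*-comm _ _) (*-comm _ _) ⟩
    G 0 * F 1 + G 1 * F 0         ≈⟨ +-congˡ (+-identityʳ _) ⟨
    G 0 * F 1 + (G 1 * F 0 + 0#)  ∎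
  ⋆-comm F G (suc (suc n)) = begin
    F 0 * G (suc (suc n)) + ((F ∘ suc) ⋆ G) (suc n)
      ≈⟨ +-congˡ (⋆-comm (F ∘ suc) G (suc n)) ⟩
    F 0 * G (suc (suc n)) + (G 0 * F (suc (suc n)) + ((G ∘ suc) ⋆ (F ∘ suc)) n)
      ≈⟨ +-congˡ (+-congˡ (⋆-comm (G ∘ suc) (F ∘ suc) n)) ⟩
    F 0 * G (suc (suc n)) + (G 0 * F (suc (suc n)) + ((F ∘ suc) ⋆ (G ∘ suc)) n)
      ≈⟨ x∙yz≈y∙xz _ _ _ ⟩
    G 0 * F (suc (suc n)) + (F ⋆ (G ∘ suc)) (suc n)
      ≈⟨ +-congˡ (⋆-comm (G ∘ suc) F (suc n)) ⟨
    G 0 * F (suc (suc n)) + ((G ∘ suc) ⋆ F) (suc n)  ∎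

  ⋆-assoc : ∀ F G K → (F ⋆ G) ⋆ K ≋ F ⋆ (G ⋆ K)
  ⋆-assoc F G K zero = +-congʳ (begin
    (F 0 * G 0 + 0#) * K 0  ≈⟨ *-congʳ (+-identityʳ _) ⟩
    F 0 * G 0 * K 0         ≈⟨ *-assoc _ _ _ ⟩
    F 0 * (G 0 * K 0)       ≈⟨ *-congˡ (+-identityʳ _) ⟨
    F 0 * (G 0 * K 0 + 0#)  ∎)
  ⋆-assoc F G K (suc n) = begin
    (F 0 * G 0 + 0#) * K (suc n) + ((λ i → F 0 * G (suc i) + ((F ∘ suc) ⋆ G) i) ⋆ K) n
      ≈⟨ +-cong (*-congʳ (+-identityʳ _)) (⋆-distribʳ (λ i → F 0 * G (suc i)) ((F ∘ suc) ⋆ G) K n) ⟩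
    F 0 * G 0 * K (suc n) + (((λ i → F 0 * G (suc i)) ⋆ K) n + (((F ∘ suc) ⋆ G) ⋆ K) n)
      ≈⟨ +-cong (*-assoc _ _ _) (+-cong (⋆-scaleˡ (F 0) (G ∘ suc) K n) (⋆-assoc (F ∘ suc) G K n)) ⟩
    F 0 * (G 0 * K (suc n)) + (F 0 * ((G ∘ suc) ⋆ K) n + ((F ∘ suc) ⋆ (G ⋆ K)) n)
      ≈⟨ +-assoc _ _ _ ⟨
    (F 0 * (G 0 * K (suc n)) + F 0 * ((G ∘ suc) ⋆ K) n) + ((F ∘ suc) ⋆ (G ⋆ K)) n
      ≈⟨ +-congʳ (distribˡ (F 0) _ _) ⟨
    F 0 * (G 0 * K (suc n) + ((G ∘ suc) ⋆ K) n) + ((F ∘ suc) ⋆ (G ⋆ K)) n  ∎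

  ⋆-identityˡ : ∀ F → 𝟙 ⋆ F ≋ F
  ⋆-identityˡ F n = trans (ι-⋆ 1# F n) (*-identityˡ (F n))

  ≋-isEquivalence : IsEquivalence _≋_
  ≋-isEquivalence = record
    { refl  = λ _ → refl
    ; sym   = λ F≋G n → sym (F≋G n)
    ; trans = λ F≋G G≋K n → trans (F≋G n) (G≋K n)
    }

  ⊕-isAbelianGroup : IsAbelianGroup _≋_ _⊕_ 𝟘 ⊖_
  ⊕-isAbelianGroup = record
    { isGroup = record
      { isMonoid = record
        { isSemigroup = record
          { isMagma = record
            { isEquivalence = ≋-isEquivalence
            ; ∙-cong        = λ F≋F′ G≋G′ n → +-cong (F≋F′ n) (G≋G′ n)
            }
          ; assoc = λ F G K n → +-assoc (F n) (G n) (K n)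
          }
        ; identity = (λ F n → +-identityˡ (F n)) , (λ F n → +-identityʳ (F n))
        }
      ; inverse = (λ F n → -‿inverseˡ (F n)) , (λ F n → -‿inverseʳ (F n))
      ; ⁻¹-cong = λ F≋G n → -‿cong (F≋G n)
      }
    ; comm = λ F G n → +-comm (F n) (G n)
    }

  ⋆-isCommutativeRing : IsCommutativeRing _≋_ _⊕_ _⋆_ ⊖_ 𝟘 𝟙
  ⋆-isCommutativeRing = record
    { isRing = record
      { +-isAbelianGroup = ⊕-isAbelianGroup
      ; *-cong           = ⋆-cong
      ; *-assoc          = ⋆-assoc
      ; *-identity       = ⋆-identityˡ , λ F n → trans (⋆-comm F 𝟙 n) (⋆-identityˡ F n)
      ; distrib          = (λ F G K n → trans (⋆-comm F (G ⊕ K) n)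
                                         (trans (⋆-distribʳ G K F n)
                                                (+-cong (⋆-comm G F n) (⋆-comm K F n))))
                         , (λ K F G → ⋆-distribʳ F G K)
      }
    ; *-comm = ⋆-comm
    }

  commutativeRing : CommutativeRing c ℓ
  commutativeRing = record { isCommutativeRing = ⋆-isCommutativeRing }

module BargraphAlgebra {c ℓ} (R : CommutativeRing c ℓ)
  (ℤ→R : CommutativeRing.rawRing ℤP.+-*-commutativeRing -Raw-AlmostCommutative⟶ fromCommutativeRing R)
  where

  open CommutativeRing R
  open _-Raw-AlmostCommutative⟶_ ℤ→R using (⟦_⟧)
  open import Relation.Binary.Reasoning.Setoid setoid

  private
    coeff≟ : ∀ a b → Maybe (⟦ a ⟧ ≈ ⟦ b ⟧)
    coeff≟ a b with a ℤ.≟ b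
    ... | yes ≡.refl = just refl
    ... | no _       = nothing

  open import Algebra.Solver.Ring
    (CommutativeRing.rawRing ℤP.+-*-commutativeRing) (fromCommutativeRing R) ℤ→R coeff≟
    using (Polynomial; solve; _:=_; con; _:+_; _:-_; _:*_)

  numerator radicand : Carrier → Carrier → Carrier
  numerator x y = ⟦ + 1 ⟧ - ⟦ + 2 ⟧ * x - y + ⟦ + 2 ⟧ * x * y + x * x
  radicand x y  = ((⟦ + 1 ⟧ - x) * (⟦ + 1 ⟧ - x) - y)
                  * ((⟦ + 1 ⟧ - x) * (⟦ + 1 ⟧ - x) - y * ((⟦ + 1 ⟧ - ⟦ + 2 ⟧ * x) * (⟦ + 1 ⟧ - ⟦ + 2 ⟧ * x)))

  denominator : Carrier → Carrier
  denominator x = ⟦ + 2 ⟧ * x * (⟦ + 1 ⟧ - x)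

  private
    numeratorᴾ radicandᴾ : ∀ {n} → Polynomial n → Polynomial n → Polynomial n
    numeratorᴾ x y = con (+ 1) :- con (+ 2) :* x :- y :+ con (+ 2) :* x :* y :+ x :* x
    radicandᴾ x y  = ((con (+ 1) :- x) :* (con (+ 1) :- x) :- y)
                     :* ((con (+ 1) :- x) :* (con (+ 1) :- x) :- y :* ((con (+ 1) :- con (+ 2) :* x) :* (con (+ 1) :- con (+ 2) :* x)))

  record Recurrences (x y : Carrier) (u p d v : ℕ → Carrier) : Set ℓ where
    field
      up     : ∀ h → u h ≈ y * u (suc h) + x * p h
      peak   : ∀ h → p h ≈ x * p h + d h
      down   : ∀ h → d (suc h) ≈ d h + x * v h
      valley : ∀ h → v h ≈ x * v h + y * u (suc h)
      base   : d 0 ≈ ⟦ + 1 ⟧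

  module _ {x y : Carrier} {u p d v : ℕ → Carrier} (rec : Recurrences x y u p d v) where

    open Recurrences rec

    upError peakError downError valleyError ascentError : ℕ → Carrier
    upError     h = u h - u 0 * d h
    peakError   h = p h - p 0 * d h
    downError   h = d (suc h) - d 1 * d h
    valleyError h = v h - v 0 * d h
    ascentError h = u (suc h) - u 1 * d h

    peakError-rec : ∀ h → peakError h ≈ x * peakError h
    peakError-rec h = begin
      p h - p 0 * d h
        ≈⟨ +-cong (peak h) (-‿cong (*-congʳ (trans (peak 0) (+-congˡ base)))) ⟩
      (x * p h + d h) - (x * p 0 + ⟦ + 1 ⟧) * d h
        ≈⟨ solve 4 (λ x pₕ p₀ dₕ → (x :* pₕ :+ dₕ) :- (x :* p₀ :+ con (+ 1)) :* dₕ := x :* (pₕ :- p₀ :* dₕ))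
                   refl x (p h) (p 0) (d h) ⟩
      x * (p h - p 0 * d h)
        ∎

    downError-rec : ∀ h → downError h ≈ x * valleyError h
    downError-rec h = begin
      d (suc h) - d 1 * d h
        ≈⟨ +-cong (down h) (-‿cong (*-congʳ (trans (down 0) (+-congʳ base)))) ⟩
      (d h + x * v h) - (⟦ + 1 ⟧ + x * v 0) * d h
        ≈⟨ solve 4 (λ x dₕ vₕ v₀ → (dₕ :+ x :* vₕ) :- (con (+ 1) :+ x :* v₀) :* dₕ := x :* (vₕ :- v₀ :* dₕ))
                   refl x (d h) (v h) (v 0) ⟩
      x * (v h - v 0 * d h)
        ∎

    valleyError-rec : ∀ h → valleyError h ≈ x * valleyError h + y * ascentError h
    valleyError-rec h = begin
      v h - v 0 * d h
        ≈⟨ +-cong (valley h) (-‿cong (*-congʳ (valley 0))) ⟩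
      (x * v h + y * u (suc h)) - (x * v 0 + y * u 1) * d h
        ≈⟨ solve 7 (λ x y vₕ uₕ₊₁ v₀ u₁ dₕ → (x :* vₕ :+ y :* uₕ₊₁) :- (x :* v₀ :+ y :* u₁) :* dₕ
                                             := x :* (vₕ :- v₀ :* dₕ) :+ y :* (uₕ₊₁ :- u₁ :* dₕ))
                   refl x y (v h) (u (suc h)) (v 0) (u 1) (d h) ⟩
      x * (v h - v 0 * d h) + y * (u (suc h) - u 1 * d h)
        ∎

    upError-rec : ∀ h → upError h ≈ y * ascentError h + x * peakError h
    upError-rec h = begin
      u h - u 0 * d h
        ≈⟨ +-cong (up h) (-‿cong (*-congʳ (up 0))) ⟩
      (y * u (suc h) + x * p h) - (y * u 1 + x * p 0) * d h
        ≈⟨ solve 7 (λ x y uₕ₊₁ pₕ u₁ p₀ dₕ → (y :* uₕ₊₁ :+ x :* pₕ) :- (y :* u₁ :+ x :* p₀) :* dₕ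
                                             := y :* (uₕ₊₁ :- u₁ :* dₕ) :+ x :* (pₕ :- p₀ :* dₕ))
                   refl x y (u (suc h)) (p h) (u 1) (p 0) (d h) ⟩
      y * (u (suc h) - u 1 * d h) + x * (p h - p 0 * d h)
        ∎

    ascentError-split : ∀ h → ascentError h ≈ upError (suc h) + u 0 * downError h - upError 1 * d h
    ascentError-split h = solve 6 (λ uₕ₊₁ u₁ u₀ dₕ₊₁ d₁ dₕ →
      uₕ₊₁ :- u₁ :* dₕ
      := (uₕ₊₁ :- u₀ :* dₕ₊₁) :+ u₀ :* (dₕ₊₁ :- d₁ :* dₕ) :- (u₁ :- u₀ :* d₁) :* dₕ)
      refl (u (suc h)) (u 1) (u 0) (d (suc h)) (d 1) (d h)

    module _ (u₁-factorizes : u 1 ≈ u 0 * d 1) where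

      peak₀ : (⟦ + 1 ⟧ - x) * p 0 ≈ ⟦ + 1 ⟧
      peak₀ = begin
        (⟦ + 1 ⟧ - x) * p 0
          ≈⟨ solve 2 (λ x p₀ → (con (+ 1) :- x) :* p₀ := p₀ :- x :* p₀) refl x (p 0) ⟩
        p 0 - x * p 0
          ≈⟨ +-congʳ (trans (peak 0) (+-congˡ base)) ⟩
        (x * p 0 + ⟦ + 1 ⟧) - x * p 0
          ≈⟨ solve 2 (λ x p₀ → (x :* p₀ :+ con (+ 1)) :- x :* p₀ := con (+ 1)) refl x (p 0) ⟩
        ⟦ + 1 ⟧
          ∎

      valley₀ : (⟦ + 1 ⟧ - x) * v 0 ≈ y * (u 0 * d 1)
      valley₀ = begin
        (⟦ + 1 ⟧ - x) * v 0
          ≈⟨ solve 2 (λ x v₀ → (con (+ 1) :- x) :* v₀ := v₀ :- x :* v₀) refl x (v 0) ⟩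
        v 0 - x * v 0
          ≈⟨ +-congʳ (valley 0) ⟩
        (x * v 0 + y * u 1) - x * v 0
          ≈⟨ solve 3 (λ x yu₁ v₀ → (x :* v₀ :+ yu₁) :- x :* v₀ := yu₁) refl x (y * u 1) (v 0) ⟩
        y * u 1
          ≈⟨ *-congˡ u₁-factorizes ⟩
        y * (u 0 * d 1)
          ∎

      ascent₀ : (⟦ + 1 ⟧ - x) * u 0 - x ≈ y * u 0 * d 1 * (⟦ + 1 ⟧ - x)
      ascent₀ = begin
        (⟦ + 1 ⟧ - x) * u 0 - x
          ≈⟨ +-congʳ (*-congˡ (up 0)) ⟩
        (⟦ + 1 ⟧ - x) * (y * u 1 + x * p 0) - x
          ≈⟨ solve 4 (λ x y u₁ p₀ → (con (+ 1) :- x) :* (y :* u₁ :+ x :* p₀) :- x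
                                     := y :* u₁ :* (con (+ 1) :- x) :+ x :* ((con (+ 1) :- x) :* p₀) :- x)
                     refl x y (u 1) (p 0) ⟩
        y * u 1 * (⟦ + 1 ⟧ - x) + x * ((⟦ + 1 ⟧ - x) * p 0) - x
          ≈⟨ +-congʳ (+-cong (*-congʳ (*-congˡ u₁-factorizes)) (*-congˡ peak₀)) ⟩
        y * (u 0 * d 1) * (⟦ + 1 ⟧ - x) + x * ⟦ + 1 ⟧ - x
          ≈⟨ solve 4 (λ x y u₀ d₁ → y :* (u₀ :* d₁) :* (con (+ 1) :- x) :+ x :* con (+ 1) :- x
                                     := y :* u₀ :* d₁ :* (con (+ 1) :- x))
                     refl x y (u 0) (d 1) ⟩
        y * u 0 * d 1 * (⟦ + 1 ⟧ - x)
          ∎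

      descent₀ : d 1 * ((⟦ + 1 ⟧ - x) - x * y * u 0) ≈ ⟦ + 1 ⟧ - x
      descent₀ = begin
        d 1 * ((⟦ + 1 ⟧ - x) - x * y * u 0)
          ≈⟨ solve 4 (λ x y u₀ d₁ → d₁ :* ((con (+ 1) :- x) :- x :* y :* u₀)
                                     := (con (+ 1) :- x) :* d₁ :- x :* (y :* (u₀ :* d₁)))
                     refl x y (u 0) (d 1) ⟩
        (⟦ + 1 ⟧ - x) * d 1 - x * (y * (u 0 * d 1))
          ≈⟨ +-cong (*-congˡ (trans (down 0) (+-congʳ base))) (-‿cong (*-congˡ (sym valley₀))) ⟩
        (⟦ + 1 ⟧ - x) * (⟦ + 1 ⟧ + x * v 0) - x * ((⟦ + 1 ⟧ - x) * v 0)
          ≈⟨ solve 2 (λ x v₀ → (con (+ 1) :- x) :* (con (+ 1) :+ x :* v₀) :- x :* ((con (+ 1) :- x) :* v₀)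
                               := con (+ 1) :- x)
                     refl x (v 0) ⟩
        ⟦ + 1 ⟧ - x
          ∎

      ascent₀∙descent₀ : ((⟦ + 1 ⟧ - x) * u 0 - x) * ((⟦ + 1 ⟧ - x) - x * y * u 0)
                         ≈ y * u 0 * (⟦ + 1 ⟧ - x) * (⟦ + 1 ⟧ - x)
      ascent₀∙descent₀ = begin
        ((⟦ + 1 ⟧ - x) * u 0 - x) * ((⟦ + 1 ⟧ - x) - x * y * u 0)
          ≈⟨ *-congʳ ascent₀ ⟩
        y * u 0 * d 1 * (⟦ + 1 ⟧ - x) * ((⟦ + 1 ⟧ - x) - x * y * u 0)
          ≈⟨ solve 4 (λ x y u₀ d₁ → y :* u₀ :* d₁ :* (con (+ 1) :- x) :* ((con (+ 1) :- x) :- x :* y :* u₀)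
                                     := y :* u₀ :* (con (+ 1) :- x) :* (d₁ :* ((con (+ 1) :- x) :- x :* y :* u₀)))
                     refl x y (u 0) (d 1) ⟩
        y * u 0 * (⟦ + 1 ⟧ - x) * (d 1 * ((⟦ + 1 ⟧ - x) - x * y * u 0))
          ≈⟨ *-congˡ descent₀ ⟩
        y * u 0 * (⟦ + 1 ⟧ - x) * (⟦ + 1 ⟧ - x)
          ∎

      quadratic : x * (⟦ + 1 ⟧ - x) * (y * u 0 * (y * u 0) + y) ≈ numerator x y * (y * u 0)
      quadratic = begin
        x * (⟦ + 1 ⟧ - x) * (y * u 0 * (y * u 0) + y)
          ≈⟨ solve 3 (λ x y u₀ → x :* (con (+ 1) :- x) :* (y :* u₀ :* (y :* u₀) :+ y)
                                  := numeratorᴾ x y :* (y :* u₀) :+ y :* (y :* u₀ :* (con (+ 1) :- x) :* (con (+ 1) :- x))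
                                     :- y :* (((con (+ 1) :- x) :* u₀ :- x) :* ((con (+ 1) :- x) :- x :* y :* u₀)))
                     refl x y (u 0) ⟩
        numerator x y * (y * u 0) + y * (y * u 0 * (⟦ + 1 ⟧ - x) * (⟦ + 1 ⟧ - x))
          - y * (((⟦ + 1 ⟧ - x) * u 0 - x) * ((⟦ + 1 ⟧ - x) - x * y * u 0))
          ≈⟨ +-congˡ (-‿cong (*-congˡ ascent₀∙descent₀)) ⟩
        numerator x y * (y * u 0) + y * (y * u 0 * (⟦ + 1 ⟧ - x) * (⟦ + 1 ⟧ - x))
          - y * (y * u 0 * (⟦ + 1 ⟧ - x) * (⟦ + 1 ⟧ - x))
          ≈⟨ solve 3 (λ n y k → n :+ y :* k :- y :* k := n) refl (numerator x y * (y * u 0)) y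
                     (y * u 0 * (⟦ + 1 ⟧ - x) * (⟦ + 1 ⟧ - x)) ⟩
        numerator x y * (y * u 0)
          ∎

      discriminant : (numerator x y - denominator x * (y * u 0)) * (numerator x y - denominator x * (y * u 0))
                     ≈ radicand x y
      discriminant = begin
        (numerator x y - denominator x * (y * u 0)) * (numerator x y - denominator x * (y * u 0))
          ≈⟨ solve 3 (λ x y u₀ → (numeratorᴾ x y :- con (+ 2) :* x :* (con (+ 1) :- x) :* (y :* u₀))
                                   :* (numeratorᴾ x y :- con (+ 2) :* x :* (con (+ 1) :- x) :* (y :* u₀))
                                  := numeratorᴾ x y :* numeratorᴾ x y
                                     :- con (+ 4) :* x :* (con (+ 1) :- x) :* (numeratorᴾ x y :* (y :* u₀))
                                     :+ con (+ 4) :* x :* (con (+ 1) :- x)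
                                        :* (x :* (con (+ 1) :- x) :* (y :* u₀ :* (y :* u₀) :+ y))
                                     :- con (+ 4) :* x :* x :* (con (+ 1) :- x) :* (con (+ 1) :- x) :* y)
                     refl x y (u 0) ⟩
        numerator x y * numerator x y - ⟦ + 4 ⟧ * x * (⟦ + 1 ⟧ - x) * (numerator x y * (y * u 0))
          + ⟦ + 4 ⟧ * x * (⟦ + 1 ⟧ - x) * (x * (⟦ + 1 ⟧ - x) * (y * u 0 * (y * u 0) + y))
          - ⟦ + 4 ⟧ * x * x * (⟦ + 1 ⟧ - x) * (⟦ + 1 ⟧ - x) * y
          ≈⟨ +-congʳ (+-congˡ (*-congˡ quadratic)) ⟩
        numerator x y * numerator x y - ⟦ + 4 ⟧ * x * (⟦ + 1 ⟧ - x) * (numerator x y * (y * u 0))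
          + ⟦ + 4 ⟧ * x * (⟦ + 1 ⟧ - x) * (numerator x y * (y * u 0))
          - ⟦ + 4 ⟧ * x * x * (⟦ + 1 ⟧ - x) * (⟦ + 1 ⟧ - x) * y
          ≈⟨ solve 3 (λ x y t → numeratorᴾ x y :* numeratorᴾ x y :- con (+ 4) :* x :* (con (+ 1) :- x) :* t
                                 :+ con (+ 4) :* x :* (con (+ 1) :- x) :* t
                                 :- con (+ 4) :* x :* x :* (con (+ 1) :- x) :* (con (+ 1) :- x) :* y
                                := radicandᴾ x y)
                     refl x y (numerator x y * (y * u 0)) ⟩
        radicand x y
          ∎

-- Power series in x and y

open import Relation.Binary.PropositionalEquality using (refl; sym; trans; cong; cong₂; subst; module ≡-Reasoning)

module ℤ[[y]]      = CauchyProduct ℤP.+-*-commutativeRing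
module ℤ[[y]][[x]] = CauchyProduct ℤ[[y]].commutativeRing

PSRing : CommutativeRing _ _
PSRing = ℤ[[y]][[x]].commutativeRing

open CommutativeRing PSRing using () renaming (_≈_ to _≈ₛ_; _*_ to _⋆_; 0# to 0ₛ)
private module PS = CommutativeRing PSRing

open import Algebra.Properties.Semiring.Sum (CommutativeRing.semiring ℤP.+-*-commutativeRing)
  using (sum; sum-cong-≗; sum-replicate-zero)
import Algebra.Properties.Semiring.Sum (CommutativeRing.semiring ℤ[[y]].commutativeRing) as Σ[y]

sumℤ-upTo : ∀ m (F : ℕ → ℤ) → sumℤ (map F (upTo m)) ≡ sum {m} (F ∘ toℕ)
sumℤ-upTo m F = trans (cong sumℤ (map-applyUpTo (λ i → i) F m)) (sumℤ-applyUpTo m F)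
  where
  sumℤ-applyUpTo : ∀ m (F : ℕ → ℤ) → sumℤ (applyUpTo F m) ≡ sum {m} (F ∘ toℕ)
  sumℤ-applyUpTo zero    F = refl
  sumℤ-applyUpTo (suc m) F = cong (λ s → F 0 ℤ.+ s) (sumℤ-applyUpTo m (F ∘ suc))

sum-at : ∀ m (t : Fin m → ℤ[[y]].Seq) k → Σ[y].sum t k ≡ sum (λ i → t i k)
sum-at zero    t k = refl
sum-at (suc m) t k = cong (λ s → t zero k ℤ.+ s) (sum-at m (t ∘ suc) k)

sum-zero : ∀ m (t : Fin m → ℤ) → (∀ i → t i ≡ + 0) → sum t ≡ + 0
sum-zero m t t≡0 = trans (sum-cong-≗ t≡0) (sum-replicate-zero m)

*ₛ≈⋆ : ∀ f g → f *ₛ g ≈ₛ f ⋆ g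
*ₛ≈⋆ f g n k = begin
  (f *ₛ g) n k
    ≡⟨ sumℤ-upTo (suc n) (λ a → sumℤ (map (λ b → f a b ℤ.* g (n ∸ a) (k ∸ b)) (upTo (suc k)))) ⟩
  sum {suc n} (λ i → sumℤ (map (λ b → f (toℕ i) b ℤ.* g (n ∸ toℕ i) (k ∸ b)) (upTo (suc k))))
    ≡⟨ sum-cong-≗ {suc n} (λ i → sumℤ-upTo (suc k) (λ b → f (toℕ i) b ℤ.* g (n ∸ toℕ i) (k ∸ b))) ⟩
  sum {suc n} (λ i → (f (toℕ i) ℤ[[y]].⋆ g (n ∸ toℕ i)) k)
    ≡⟨ sum-at (suc n) (λ i → f (toℕ i) ℤ[[y]].⋆ g (n ∸ toℕ i)) k ⟨
  (f ⋆ g) n k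
    ∎
  where open ≡-Reasoning

cₛ≈ι : ∀ a → cₛ a ≈ₛ ℤ[[y]][[x]].ι (ℤ[[y]].ι a)
cₛ≈ι a zero    zero    = refl
cₛ≈ι a zero    (suc k) = refl
cₛ≈ι a (suc n) k       = refl

Xₛ≈𝕩 : Xₛ ≈ₛ ℤ[[y]][[x]].𝕩
Xₛ≈𝕩 zero                k       = refl
Xₛ≈𝕩 (suc zero)          zero    = refl
Xₛ≈𝕩 (suc zero)          (suc k) = refl
Xₛ≈𝕩 (suc (suc n))       k       = refl

Yₛ≈ι𝕩 : Yₛ ≈ₛ ℤ[[y]][[x]].ι ℤ[[y]].𝕩
Yₛ≈ι𝕩 zero    zero          = refl
Yₛ≈ι𝕩 zero    (suc zero)    = refl
Yₛ≈ι𝕩 zero    (suc (suc k)) = refl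
Yₛ≈ι𝕩 (suc n) k             = refl

cₛ-⋆ : ∀ a f n k → (cₛ a ⋆ f) n k ≡ a ℤ.* f n k
cₛ-⋆ a f n k = trans (ℤ[[y]][[x]].⋆-cong {G = f} (cₛ≈ι a) (λ _ _ → refl) n k)
                     (trans (ℤ[[y]][[x]].ι-⋆ (ℤ[[y]].ι a) f n k) (ℤ[[y]].ι-⋆ a (f n) k))

Xₛ-⋆-zero : ∀ f k → (Xₛ ⋆ f) 0 k ≡ + 0
Xₛ-⋆-zero f k = trans (ℤ[[y]][[x]].⋆-cong {G = f} Xₛ≈𝕩 (λ _ _ → refl) 0 k) (ℤ[[y]][[x]].𝕩-⋆-zero f k)

Xₛ-⋆-suc : ∀ f n k → (Xₛ ⋆ f) (suc n) k ≡ f n k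
Xₛ-⋆-suc f n k = trans (ℤ[[y]][[x]].⋆-cong {G = f} Xₛ≈𝕩 (λ _ _ → refl) (suc n) k) (ℤ[[y]][[x]].𝕩-⋆-suc f n k)

Yₛ-⋆-zero : ∀ f n → (Yₛ ⋆ f) n 0 ≡ + 0
Yₛ-⋆-zero f n = trans (ℤ[[y]][[x]].⋆-cong {G = f} Yₛ≈ι𝕩 (λ _ _ → refl) n 0)
                      (trans (ℤ[[y]][[x]].ι-⋆ ℤ[[y]].𝕩 f n 0) (ℤ[[y]].𝕩-⋆-zero (f n)))

Yₛ-⋆-suc : ∀ f n k → (Yₛ ⋆ f) n (suc k) ≡ f n k
Yₛ-⋆-suc f n k = trans (ℤ[[y]][[x]].⋆-cong {G = f} Yₛ≈ι𝕩 (λ _ _ → refl) n (suc k))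
                       (trans (ℤ[[y]][[x]].ι-⋆ ℤ[[y]].𝕩 f n (suc k)) (ℤ[[y]].𝕩-⋆-suc (f n) k))

cₛ-homomorphism : CommutativeRing.rawRing ℤP.+-*-commutativeRing -Raw-AlmostCommutative⟶ fromCommutativeRing PSRing
cₛ-homomorphism = record
  { ⟦_⟧    = cₛ
  ; +-homo = λ a b → λ { zero zero → refl ; zero (suc _) → refl ; (suc _) _ → refl }
  ; *-homo = λ a b n k → sym (trans (cₛ-⋆ a (cₛ b) n k) (*-homo a b n k))
  ; -‿homo = λ a → λ { zero zero → refl ; zero (suc _) → refl ; (suc _) _ → refl }
  ; 0-homo = λ { zero zero → refl ; zero (suc _) → refl ; (suc _) _ → refl }
  ; 1-homo = λ { zero zero → refl ; zero (suc _) → refl ; (suc _) _ → refl }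
  }
  where
  *-homo : ∀ a b n k → a ℤ.* cₛ b n k ≡ cₛ (a ℤ.* b) n k
  *-homo a b zero    zero    = refl
  *-homo a b zero    (suc k) = ℤP.*-zeroʳ a
  *-homo a b (suc n) k       = ℤP.*-zeroʳ a

VanishesBelow : ℕ → PS → Set
VanishesBelow m f = ∀ n k → n ℕ.+ k < m → f n k ≡ + 0

vanishesBelow-resp : ∀ {m f g} → f ≈ₛ g → VanishesBelow m g → VanishesBelow m f
vanishesBelow-resp f≈g g≈0 n k n+k<m = trans (f≈g n k) (g≈0 n k n+k<m)

vanishesBelow-+ : ∀ {m f g} → VanishesBelow m f → VanishesBelow m g → VanishesBelow m (f +ₛ g)
vanishesBelow-+ f≈0 g≈0 n k n+k<m = cong₂ ℤ._+_ (f≈0 n k n+k<m) (g≈0 n k n+k<m)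

vanishesBelow-diff : ∀ {m f g} → VanishesBelow m f → VanishesBelow m g → VanishesBelow m (f -ₛ g)
vanishesBelow-diff f≈0 g≈0 n k n+k<m = cong₂ ℤ._-_ (f≈0 n k n+k<m) (g≈0 n k n+k<m)

vanishesBelow-⋆ˡ : ∀ {m f} g → VanishesBelow m f → VanishesBelow m (f ⋆ g)
vanishesBelow-⋆ˡ {m} {f} g f≈0 n k n+k<m =
  trans (sum-at (suc n) (λ i → f (toℕ i) ℤ[[y]].⋆ g (n ∸ toℕ i)) k)
        (sum-zero (suc n) _ λ i → sum-zero (suc k) _ λ j →
          trans (cong (ℤ._* g (n ∸ toℕ i) (k ∸ toℕ j))
                      (f≈0 (toℕ i) (toℕ j) (ℕ.≤-<-trans (ℕ.+-mono-≤ (toℕ≤pred[n] i) (toℕ≤pred[n] j)) n+k<m)))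
                (ℤP.*-zeroˡ (g (n ∸ toℕ i) (k ∸ toℕ j))))

vanishesBelow-⋆ʳ : ∀ {m g} f → VanishesBelow m g → VanishesBelow m (f ⋆ g)
vanishesBelow-⋆ʳ {g = g} f g≈0 = vanishesBelow-resp (ℤ[[y]][[x]].⋆-comm f g) (vanishesBelow-⋆ˡ f g≈0)

vanishesBelow-Xₛ⋆ : ∀ {m f} → VanishesBelow m f → VanishesBelow (suc m) (Xₛ ⋆ f)
vanishesBelow-Xₛ⋆ {f = f} f≈0 zero    k _               = Xₛ-⋆-zero f k
vanishesBelow-Xₛ⋆ {f = f} f≈0 (suc n) k (s≤s n+k<m) = trans (Xₛ-⋆-suc f n k) (f≈0 n k n+k<m)

vanishesBelow-Yₛ⋆ : ∀ {m f} → VanishesBelow m f → VanishesBelow (suc m) (Yₛ ⋆ f)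
vanishesBelow-Yₛ⋆ {f = f} f≈0 n zero    _         = Yₛ-⋆-zero f n
vanishesBelow-Yₛ⋆ {m} {f} f≈0 n (suc k) n+1+k<1+m =
  trans (Yₛ-⋆-suc f n k) (f≈0 n k (ℕ.≤-pred (subst (_< suc m) (ℕ.+-suc n k) n+1+k<1+m)))

vanishesEverywhere : ∀ {f} → (∀ m → VanishesBelow m f) → f ≈ₛ 0ₛ
vanishesEverywhere f≈0 n k = f≈0 (suc (n ℕ.+ k)) n k ℕ.≤-refl

-- Weakly alternating bargraphs as the language of an automaton

positiveUntilZero : ℤ → List Step → Bool
positiveUntilZero h []      = does (h ℤ.≟ + 0)
positiveUntilZero h (s ∷ w) = does (+ 0 <? h) ∧ positiveUntilZero (h ℤ.+ dy s) w

interiorPosEndZero-heightsAfter : ∀ h s w →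
  interiorPosEndZero (heightsAfter h (s ∷ w)) ≡ positiveUntilZero (h ℤ.+ dy s) w
interiorPosEndZero-heightsAfter h s []       = refl
interiorPosEndZero-heightsAfter h s (t ∷ w) =
  cong (does (+ 0 <? (h ℤ.+ dy s)) ∧_) (interiorPosEndZero-heightsAfter (h ℤ.+ dy s) t w)

data RunPhase : Set where
  expectU expectH expectD afterDescent : RunPhase

runPattern : RunPhase → List Step → Bool
runPattern expectU      (U ∷ l) = runPattern expectH l
runPattern expectH      (H ∷ l) = runPattern expectD l
runPattern expectD      (D ∷ l) = runPattern afterDescent l
runPattern afterDescent []      = true
runPattern afterDescent (H ∷ l) = runPattern expectU l
runPattern _            _       = false

patWA≡runPattern : ∀ l → patWA l ≡ runPattern expectU l
patWA≡runPattern []                  = refl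
patWA≡runPattern (H ∷ _)             = refl
patWA≡runPattern (D ∷ _)             = refl
patWA≡runPattern (U ∷ [])            = refl
patWA≡runPattern (U ∷ U ∷ _)         = refl
patWA≡runPattern (U ∷ D ∷ _)         = refl
patWA≡runPattern (U ∷ H ∷ [])        = refl
patWA≡runPattern (U ∷ H ∷ U ∷ _)     = refl
patWA≡runPattern (U ∷ H ∷ H ∷ _)     = refl
patWA≡runPattern (U ∷ H ∷ D ∷ rest)  = afterFirstRun rest
  where
  afterFirstRun : ∀ r → patWA (U ∷ H ∷ D ∷ r) ≡ runPattern afterDescent r
  afterFirstRun []                    = refl
  afterFirstRun (U ∷ _)               = refl
  afterFirstRun (D ∷ _)               = refl
  afterFirstRun (H ∷ [])              = refl
  afterFirstRun (H ∷ H ∷ _)           = refl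
  afterFirstRun (H ∷ D ∷ _)           = refl
  afterFirstRun (H ∷ U ∷ [])          = refl
  afterFirstRun (H ∷ U ∷ U ∷ _)       = refl
  afterFirstRun (H ∷ U ∷ D ∷ _)       = refl
  afterFirstRun (H ∷ U ∷ H ∷ [])      = refl
  afterFirstRun (H ∷ U ∷ H ∷ U ∷ _)   = refl
  afterFirstRun (H ∷ U ∷ H ∷ H ∷ _)   = refl
  afterFirstRun (H ∷ U ∷ H ∷ D ∷ r)   = afterFirstRun r

runLetters-head : ∀ s w → ∃ λ rest → runLetters (s ∷ w) ≡ s ∷ rest
runLetters-head s []       = [] , refl
runLetters-head U (U ∷ w) = runLetters-head U w
runLetters-head U (H ∷ w) = _ , refl
runLetters-head U (D ∷ w) = _ , refl
runLetters-head H (U ∷ w) = _ , refl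
runLetters-head H (H ∷ w) = runLetters-head H w
runLetters-head H (D ∷ w) = _ , refl
runLetters-head D (U ∷ w) = _ , refl
runLetters-head D (H ∷ w) = _ , refl
runLetters-head D (D ∷ w) = runLetters-head D w

runLetters-rejected : ∀ (f : List Step → Bool) t w → (∀ rest → f (t ∷ rest) ≡ false) → f (runLetters (t ∷ w)) ≡ false
runLetters-rejected f t w rejects = let rest , runLetters≡t∷rest = runLetters-head t w in
  trans (cong f runLetters≡t∷rest) (rejects rest)

-- peak h: inside the H-run after an ascent; valley h: inside the H-run after a descent.
data State : Set where
  up peak down valley : ℕ → State

height : State → ℕ
height (up h)     = suc h
height (peak h)   = suc h
height (down h)   = h
height (valley h) = suc h

lastStep : State → Step
lastStep (up _)     = U
lastStep (peak _)   = H
lastStep (down _)   = D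
lastStep (valley _) = H

phase : State → RunPhase
phase (up _)     = expectU
phase (peak _)   = expectH
phase (down _)   = expectD
phase (valley _) = afterDescent

accepts : State → List Step → Bool
accepts (up h)         (U ∷ w) = accepts (up (suc h)) w
accepts (up h)         (H ∷ w) = accepts (peak h) w
accepts (peak h)       (H ∷ w) = accepts (peak h) w
accepts (peak h)       (D ∷ w) = accepts (down h) w
accepts (down (suc h)) (D ∷ w) = accepts (down h) w
accepts (down (suc h)) (H ∷ w) = accepts (valley h) w
accepts (valley h)     (H ∷ w) = accepts (valley h) w
accepts (valley h)     (U ∷ w) = accepts (up (suc h)) w
accepts (down zero)    []      = true
accepts _              _       = false

completes : State → List Step → Bool
completes s w = positiveUntilZero (+ height s) w
              ∧ (noUDDU (lastStep s ∷ w) ∧ runPattern (phase s) (runLetters (lastStep s ∷ w)))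

private
  completes-at : ∀ {a} s w → a ≡ + height s →
    positiveUntilZero a w ∧ (noUDDU (lastStep s ∷ w) ∧ runPattern (phase s) (runLetters (lastStep s ∷ w)))
    ≡ completes s w
  completes-at s w refl = refl

  +-one : ∀ h → + suc h ℤ.+ dy U ≡ + suc (suc h)
  +-one h = cong +_ (ℕ.+-comm (suc h) 1)

  +-zero : ∀ h → + suc h ℤ.+ dy H ≡ + suc h
  +-zero h = cong +_ (ℕ.+-identityʳ (suc h))

  wrongRun : ∀ a t ph w → (∀ rest → runPattern ph (t ∷ rest) ≡ false) →
    positiveUntilZero a w ∧ (noUDDU (t ∷ w) ∧ runPattern ph (runLetters (t ∷ w))) ≡ false
  wrongRun a t ph w rejects =
    trans (cong (λ b → positiveUntilZero a w ∧ (noUDDU (t ∷ w) ∧ b)) (runLetters-rejected (runPattern ph) t w rejects))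
          (trans (cong (positiveUntilZero a w ∧_) (∧-zeroʳ (noUDDU (t ∷ w)))) (∧-zeroʳ (positiveUntilZero a w)))

completes≡accepts : ∀ s w → completes s w ≡ accepts s w
completes≡accepts (up h)         []      = refl
completes≡accepts (peak h)       []      = refl
completes≡accepts (down zero)    []      = refl
completes≡accepts (down (suc h)) []      = refl
completes≡accepts (valley h)     []      = refl
completes≡accepts (down zero)    (s ∷ w) = refl
completes≡accepts (up h)         (U ∷ w) = trans (completes-at (up (suc h)) w (+-one h)) (completes≡accepts (up (suc h)) w)
completes≡accepts (up h)         (H ∷ w) = trans (completes-at (peak h) w (+-zero h)) (completes≡accepts (peak h) w)
completes≡accepts (up h)         (D ∷ w) = ∧-zeroʳ (positiveUntilZero (+ suc h ℤ.+ dy D) w)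
completes≡accepts (peak h)       (U ∷ w) = wrongRun (+ suc h ℤ.+ dy U) U expectD w (λ _ → refl)
completes≡accepts (peak h)       (H ∷ w) = trans (completes-at (peak h) w (+-zero h)) (completes≡accepts (peak h) w)
completes≡accepts (peak h)       (D ∷ w) = completes≡accepts (down h) w
completes≡accepts (down (suc h)) (U ∷ w) = ∧-zeroʳ (positiveUntilZero (+ suc h ℤ.+ dy U) w)
completes≡accepts (down (suc h)) (H ∷ w) = trans (completes-at (valley h) w (+-zero h)) (completes≡accepts (valley h) w)
completes≡accepts (down (suc h)) (D ∷ w) = completes≡accepts (down h) w
completes≡accepts (valley h)     (U ∷ w) = trans (completes-at (up (suc h)) w (+-one h)) (completes≡accepts (up (suc h)) w)
completes≡accepts (valley h)     (H ∷ w) = trans (completes-at (valley h) w (+-zero h)) (completes≡accepts (valley h) w)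
completes≡accepts (valley h)     (D ∷ w) = wrongRun (+ suc h ℤ.+ dy D) D expectU w (λ _ → refl)

acceptsFromOrigin : List Step → Bool
acceptsFromOrigin (U ∷ w) = accepts (up 0) w
acceptsFromOrigin _       = false

isWeaklyAlternatingBargraph≡acceptsFromOrigin : ∀ w →
  isBargraph w ∧ isWeaklyAlternating w ≡ acceptsFromOrigin w
isWeaklyAlternatingBargraph≡acceptsFromOrigin []      = refl
isWeaklyAlternatingBargraph≡acceptsFromOrigin (U ∷ w) = begin
  (interiorPosEndZero (heightsAfter (+ 0) (U ∷ w)) ∧ noUDDU (U ∷ w)) ∧ patWA (runLetters (U ∷ w))
    ≡⟨ cong (λ b → (b ∧ noUDDU (U ∷ w)) ∧ patWA (runLetters (U ∷ w))) (interiorPosEndZero-heightsAfter (+ 0) U w) ⟩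
  (positiveUntilZero (+ 1) w ∧ noUDDU (U ∷ w)) ∧ patWA (runLetters (U ∷ w))
    ≡⟨ ∧-assoc (positiveUntilZero (+ 1) w) (noUDDU (U ∷ w)) _ ⟩
  positiveUntilZero (+ 1) w ∧ (noUDDU (U ∷ w) ∧ patWA (runLetters (U ∷ w)))
    ≡⟨ cong (λ b → positiveUntilZero (+ 1) w ∧ (noUDDU (U ∷ w) ∧ b)) (patWA≡runPattern (runLetters (U ∷ w))) ⟩
  completes (up 0) w
    ≡⟨ completes≡accepts (up 0) w ⟩
  accepts (up 0) w
    ∎
  where open ≡-Reasoning
isWeaklyAlternatingBargraph≡acceptsFromOrigin (H ∷ w) =
  trans (cong (isBargraph (H ∷ w) ∧_) (runLetters-rejected patWA H w (λ _ → refl))) (∧-zeroʳ (isBargraph (H ∷ w)))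
isWeaklyAlternatingBargraph≡acceptsFromOrigin (D ∷ w) =
  trans (cong (isBargraph (D ∷ w) ∧_) (runLetters-rejected patWA D w (λ _ → refl))) (∧-zeroʳ (isBargraph (D ∷ w)))

-- Counting words by weight

indicator : Bool → ℕ
indicator b = if b then 1 else 0

countWhere : (List Step → Bool) → List (List Step) → ℕ
countWhere p []       = 0
countWhere p (w ∷ ws) = indicator (p w) ℕ.+ countWhere p ws

length-filter≡countWhere : ∀ p ws → length (filter (λ w → p w Bool.≟ true) ws) ≡ countWhere p ws
length-filter≡countWhere p []       = refl
length-filter≡countWhere p (w ∷ ws) with p w
... | true  = cong suc (length-filter≡countWhere p ws)
... | false = length-filter≡countWhere p ws

countWhere-cong : ∀ {p q} ws → (∀ w → p w ≡ q w) → countWhere p ws ≡ countWhere q ws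
countWhere-cong []       p≗q = refl
countWhere-cong (w ∷ ws) p≗q = cong₂ ℕ._+_ (cong indicator (p≗q w)) (countWhere-cong ws p≗q)

countWhere-false : ∀ {p} ws → (∀ w → p w ≡ false) → countWhere p ws ≡ 0
countWhere-false []       p≗false = refl
countWhere-false (w ∷ ws) p≗false rewrite p≗false w = countWhere-false ws p≗false

countWhere-words-suc : ∀ p L → countWhere p (words (suc L))
  ≡ countWhere (λ w → p (U ∷ w)) (words L)
    ℕ.+ (countWhere (λ w → p (H ∷ w)) (words L) ℕ.+ countWhere (λ w → p (D ∷ w)) (words L))
countWhere-words-suc p L = go (words L)
  where
  shuffle : ∀ a b c a′ b′ c′ → a ℕ.+ (b ℕ.+ (c ℕ.+ (a′ ℕ.+ (b′ ℕ.+ c′)))) ≡ (a ℕ.+ a′) ℕ.+ ((b ℕ.+ b′) ℕ.+ (c ℕ.+ c′))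
  shuffle = solve-∀
  go : ∀ ws → countWhere p (concatMap (λ w → (U ∷ w) ∷ (H ∷ w) ∷ (D ∷ w) ∷ []) ws)
    ≡ countWhere (λ w → p (U ∷ w)) ws ℕ.+ (countWhere (λ w → p (H ∷ w)) ws ℕ.+ countWhere (λ w → p (D ∷ w)) ws)
  go []       = refl
  go (w ∷ ws) rewrite go ws = shuffle (indicator (p (U ∷ w))) (indicator (p (H ∷ w))) (indicator (p (D ∷ w))) _ _ _

hasWeight : ℕ → ℕ → List Step → Bool
hasWeight n k w = (#H w ℕ.≡ᵇ n) ∧ (#U w ℕ.≡ᵇ k)

-- A word leading from height h down to the axis with n H-steps and k U-steps has
-- k + h D-steps, hence length h + (n + 2k).
seriesFrom : ℕ → (List Step → Bool) → PS
seriesFrom h p n k = + countWhere (λ w → p w ∧ hasWeight n k w) (words (h ℕ.+ (n ℕ.+ 2 ℕ.* k)))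

seriesFrom-never : ∀ h → seriesFrom h (λ _ → false) ≈ₛ 0ₛ
seriesFrom-never h n k = cong +_ (countWhere-false (words (h ℕ.+ (n ℕ.+ 2 ℕ.* k))) (λ _ → refl))

private
  branch-U : ∀ h q n k → + countWhere (λ w → q w ∧ hasWeight n k (U ∷ w)) (words (h ℕ.+ (n ℕ.+ 2 ℕ.* k)))
                         ≡ (Yₛ ⋆ seriesFrom (suc (suc h)) q) n k
  branch-U h q n zero    = trans (cong +_ (countWhere-false (words (h ℕ.+ (n ℕ.+ 0)))
                                             λ w → trans (cong (q w ∧_) (∧-zeroʳ _)) (∧-zeroʳ (q w))))
                                 (sym (Yₛ-⋆-zero (seriesFrom (suc (suc h)) q) n))
  branch-U h q n (suc k) = trans (cong (λ L → + countWhere (λ w → q w ∧ hasWeight n k w) (words L)) (length≡ h n k))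
                                 (sym (Yₛ-⋆-suc (seriesFrom (suc (suc h)) q) n k))
    where
    length≡ : ∀ h n k → h ℕ.+ (n ℕ.+ 2 ℕ.* suc k) ≡ suc (suc h) ℕ.+ (n ℕ.+ 2 ℕ.* k)
    length≡ = solve-∀

  branch-H : ∀ h q n k → + countWhere (λ w → q w ∧ hasWeight n k (H ∷ w)) (words (h ℕ.+ (n ℕ.+ 2 ℕ.* k)))
                         ≡ (Xₛ ⋆ seriesFrom (suc h) q) n k
  branch-H h q zero    k = trans (cong +_ (countWhere-false (words (h ℕ.+ 2 ℕ.* k)) λ w → ∧-zeroʳ (q w)))
                                 (sym (Xₛ-⋆-zero (seriesFrom (suc h) q) k))
  branch-H h q (suc n) k = trans (cong (λ L → + countWhere (λ w → q w ∧ hasWeight n k w) (words L))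
                                       (ℕ.+-suc h (n ℕ.+ 2 ℕ.* k)))
                                 (sym (Xₛ-⋆-suc (seriesFrom (suc h) q) n k))

seriesFrom-suc : ∀ h p → seriesFrom (suc h) p
  ≈ₛ Yₛ ⋆ seriesFrom (suc (suc h)) (λ w → p (U ∷ w))
     +ₛ (Xₛ ⋆ seriesFrom (suc h) (λ w → p (H ∷ w)) +ₛ seriesFrom h (λ w → p (D ∷ w)))
seriesFrom-suc h p n k =
  trans (cong +_ (countWhere-words-suc (λ w → p w ∧ hasWeight n k w) (h ℕ.+ (n ℕ.+ 2 ℕ.* k))))
        (cong₂ ℤ._+_ (branch-U h (λ w → p (U ∷ w)) n k) (cong₂ ℤ._+_ (branch-H h (λ w → p (H ∷ w)) n k) refl))

seriesFrom-origin : seriesFrom 0 acceptsFromOrigin ≈ₛ Yₛ ⋆ seriesFrom 1 (accepts (up 0))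
seriesFrom-origin n zero    = trans (cong +_ (countWhere-false (words (n ℕ.+ 0)) noU))
                                    (sym (Yₛ-⋆-zero (seriesFrom 1 (accepts (up 0))) n))
  where
  noU : ∀ w → acceptsFromOrigin w ∧ hasWeight n 0 w ≡ false
  noU []      = refl
  noU (U ∷ w) = trans (cong (accepts (up 0) w ∧_) (∧-zeroʳ _)) (∧-zeroʳ (accepts (up 0) w))
  noU (H ∷ w) = refl
  noU (D ∷ w) = refl
seriesFrom-origin n (suc k) = begin
  + countWhere (λ w → acceptsFromOrigin w ∧ hasWeight n (suc k) w) (words (n ℕ.+ 2 ℕ.* suc k))
    ≡⟨ cong (λ L → + countWhere (λ w → acceptsFromOrigin w ∧ hasWeight n (suc k) w) (words L)) (length≡ n k) ⟩
  + countWhere (λ w → acceptsFromOrigin w ∧ hasWeight n (suc k) w) (words (suc (suc (n ℕ.+ 2 ℕ.* k))))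
    ≡⟨ cong +_ (countWhere-words-suc (λ w → acceptsFromOrigin w ∧ hasWeight n (suc k) w) (suc (n ℕ.+ 2 ℕ.* k))) ⟩
  + (seriesCoeff ℕ.+ (countWhere (λ _ → false) ws ℕ.+ countWhere (λ _ → false) ws))
    ≡⟨ cong (λ c → + (seriesCoeff ℕ.+ c))
            (cong₂ ℕ._+_ (countWhere-false ws (λ _ → refl)) (countWhere-false ws (λ _ → refl))) ⟩
  + (seriesCoeff ℕ.+ 0)
    ≡⟨ cong +_ (ℕ.+-identityʳ seriesCoeff) ⟩
  seriesFrom 1 (accepts (up 0)) n k
    ≡⟨ Yₛ-⋆-suc (seriesFrom 1 (accepts (up 0))) n k ⟨
  (Yₛ ⋆ seriesFrom 1 (accepts (up 0))) n (suc k)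
    ∎
  where
  open ≡-Reasoning
  ws = words (suc (n ℕ.+ 2 ℕ.* k))
  seriesCoeff = countWhere (λ w → accepts (up 0) w ∧ hasWeight n k w) ws
  length≡ : ∀ n k → n ℕ.+ 2 ℕ.* suc k ≡ suc (suc (n ℕ.+ 2 ℕ.* k))
  length≡ = solve-∀

BWA≈seriesFrom-origin : BWA ≈ₛ seriesFrom 0 acceptsFromOrigin
BWA≈seriesFrom-origin n k = cong +_ (trans (length-filter≡countWhere (isWAB n k) (words (n ℕ.+ 2 ℕ.* k)))
  (countWhere-cong (words (n ℕ.+ 2 ℕ.* k)) λ w →
    trans (sym (∧-assoc (isBargraph w) (isWeaklyAlternating w) (hasWeight n k w)))
          (cong (_∧ hasWeight n k w) (isWeaklyAlternatingBargraph≡acceptsFromOrigin w))))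

-- The generating series of the automaton states

open BargraphAlgebra PSRing cₛ-homomorphism

stateSeries : State → PS
stateSeries s = seriesFrom (height s) (accepts s)

private
  u p d v : ℕ → PS
  u = stateSeries ∘ up
  p = stateSeries ∘ peak
  d = stateSeries ∘ down
  v = stateSeries ∘ valley

stateRecurrences : Recurrences Xₛ Yₛ u p d v
stateRecurrences = record
  { up     = λ h → PS.trans (seriesFrom-suc h (accepts (up h)))
                            (PS.+-congˡ {Yₛ ⋆ u (suc h)} (dropNever h (Xₛ ⋆ p h)))
  ; peak   = λ h → PS.trans (seriesFrom-suc h (accepts (peak h))) (startNever h (Xₛ ⋆ p h +ₛ d h))
  ; down   = λ h → PS.trans (seriesFrom-suc h (accepts (down (suc h))))
                            (PS.trans (startNever h (Xₛ ⋆ v h +ₛ d h)) (PS.+-comm (Xₛ ⋆ v h) (d h)))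
  ; valley = λ h → PS.trans (seriesFrom-suc h (accepts (valley h)))
                            (PS.trans (PS.+-congˡ {Yₛ ⋆ u (suc h)} (dropNever h (Xₛ ⋆ v h)))
                                      (PS.+-comm (Yₛ ⋆ u (suc h)) (Xₛ ⋆ v h)))
  ; base   = onAxis
  }
  where
  dropNever : ∀ h f → f +ₛ seriesFrom h (λ _ → false) ≈ₛ f
  dropNever h f = PS.trans (PS.+-congˡ {f} (seriesFrom-never h)) (PS.+-identityʳ f)

  startNever : ∀ h f → Yₛ ⋆ seriesFrom (suc (suc h)) (λ _ → false) +ₛ f ≈ₛ f
  startNever h f = PS.trans (PS.+-congʳ {f} (PS.trans (PS.*-congˡ {Yₛ} (seriesFrom-never (suc (suc h)))) (PS.zeroʳ Yₛ)))
                            (PS.+-identityˡ f)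

  nonemptyRejected : ∀ n k L → countWhere (λ w → accepts (down 0) w ∧ hasWeight n k w) (words (suc L)) ≡ 0
  nonemptyRejected n k L = trans (countWhere-words-suc (λ w → accepts (down 0) w ∧ hasWeight n k w) L)
    (cong₂ ℕ._+_ (countWhere-false (words L) (λ _ → refl))
                 (cong₂ ℕ._+_ (countWhere-false (words L) (λ _ → refl)) (countWhere-false (words L) (λ _ → refl))))

  onAxis : d 0 ≈ₛ cₛ (+ 1)
  onAxis zero    zero    = refl
  onAxis zero    (suc k) = cong +_ (nonemptyRejected 0 (suc k) (k ℕ.+ 1 ℕ.* suc k))
  onAxis (suc n) k       = cong +_ (nonemptyRejected (suc n) k (n ℕ.+ 2 ℕ.* k))

BWA≈Yₛ⋆u₀ : BWA ≈ₛ Yₛ ⋆ u 0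
BWA≈Yₛ⋆u₀ = PS.trans BWA≈seriesFrom-origin seriesFrom-origin

record ErrorsVanishBelow (m : ℕ) : Set where
  field
    upVanishes     : ∀ h → VanishesBelow m (upError stateRecurrences h)
    peakVanishes   : ∀ h → VanishesBelow m (peakError stateRecurrences h)
    downVanishes   : ∀ h → VanishesBelow m (downError stateRecurrences h)
    valleyVanishes : ∀ h → VanishesBelow m (valleyError stateRecurrences h)

errorsVanishBelow : ∀ m → ErrorsVanishBelow m
errorsVanishBelow zero = record
  { upVanishes     = λ _ _ _ ()
  ; peakVanishes   = λ _ _ _ ()
  ; downVanishes   = λ _ _ _ ()
  ; valleyVanishes = λ _ _ _ ()
  }
errorsVanishBelow (suc m) = record
  { upVanishes     = λ h → vanishesBelow-resp (upError-rec stateRecurrences h)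
                             (vanishesBelow-+ (vanishesBelow-Yₛ⋆ (ascent h)) (vanishesBelow-Xₛ⋆ (peakVanishes h)))
  ; peakVanishes   = λ h → vanishesBelow-resp (peakError-rec stateRecurrences h)
                             (vanishesBelow-Xₛ⋆ (peakVanishes h))
  ; downVanishes   = λ h → vanishesBelow-resp (downError-rec stateRecurrences h)
                             (vanishesBelow-Xₛ⋆ (valleyVanishes h))
  ; valleyVanishes = λ h → vanishesBelow-resp (valleyError-rec stateRecurrences h)
                             (vanishesBelow-+ (vanishesBelow-Xₛ⋆ (valleyVanishes h)) (vanishesBelow-Yₛ⋆ (ascent h)))
  }
  where
  open ErrorsVanishBelow (errorsVanishBelow m)
  ascent : ∀ h → VanishesBelow m (ascentError stateRecurrences h)
  ascent h = vanishesBelow-resp (ascentError-split stateRecurrences h)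
    (vanishesBelow-diff (vanishesBelow-+ (upVanishes (suc h)) (vanishesBelow-⋆ʳ (u 0) (downVanishes h)))
                     (vanishesBelow-⋆ˡ (d h) (upVanishes 1)))

u₁-factorizes : u 1 ≈ₛ u 0 ⋆ d 1
u₁-factorizes = x∙y⁻¹≈ε⇒x≈y (u 1) (u 0 ⋆ d 1)
  (vanishesEverywhere (λ m → ErrorsVanishBelow.upVanishes (errorsVanishBelow m) 1))
  where open import Algebra.Properties.Group PS.+-group using (x∙y⁻¹≈ε⇒x≈y)

private
  *ₛ-cong : ∀ {f f′ g g′} → f ≈ₛ f′ → g ≈ₛ g′ → f *ₛ g ≈ₛ f′ ⋆ g′
  *ₛ-cong {f} {g = g} f≈f′ g≈g′ = PS.trans (*ₛ≈⋆ f g) (PS.*-cong f≈f′ g≈g′)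

  -ₛ-cong : ∀ {f f′ g g′} → f ≈ₛ f′ → g ≈ₛ g′ → f -ₛ g ≈ₛ f′ PS.- g′
  -ₛ-cong f≈f′ g≈g′ = PS.+-cong f≈f′ (PS.-‿cong g≈g′)

Pnum≈numerator : Pnum ≈ₛ numerator Xₛ Yₛ
Pnum≈numerator = PS.+-cong (PS.+-cong (-ₛ-cong (-ₛ-cong (c 1) (*ₛ-cong (c 2) X)) Y) (*ₛ-cong (*ₛ-cong (c 2) X) Y))
                           (*ₛ-cong X X)
  where
  c = λ a → PS.refl {cₛ (+ a)}
  X = PS.refl {Xₛ}
  Y = PS.refl {Yₛ}

Qrad≈radicand : Qrad ≈ₛ radicand Xₛ Yₛ
Qrad≈radicand = *ₛ-cong (-ₛ-cong (*ₛ-cong 1-x 1-x) Y) (-ₛ-cong (*ₛ-cong 1-x 1-x) (*ₛ-cong Y (*ₛ-cong 1-2x 1-2x)))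
  where
  X = PS.refl {Xₛ}
  Y = PS.refl {Yₛ}
  1-x  = -ₛ-cong (PS.refl {cₛ (+ 1)}) X
  1-2x = -ₛ-cong (PS.refl {cₛ (+ 1)}) (*ₛ-cong (PS.refl {cₛ (+ 2)}) X)

Den≈denominator : Den ≈ₛ denominator Xₛ
Den≈denominator = *ₛ-cong (*ₛ-cong (PS.refl {cₛ (+ 2)}) X) (-ₛ-cong (PS.refl {cₛ (+ 1)}) X)
  where X = PS.refl {Xₛ}

mainTheorem19 : Σ PS (λ S → (S 0 0 ≡ + 1)
                  × ((n k : ℕ) → (S *ₛ S) n k ≡ Qrad n k)
                  × ((n k : ℕ) → (Den *ₛ BWA) n k ≡ (Pnum -ₛ S) n k))
mainTheorem19 = S , refl , S²≡Qrad , (λ n k → d≡p-[p-d] (Pnum n k) ((Den *ₛ BWA) n k))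
  where
  S : PS
  S = Pnum -ₛ Den *ₛ BWA

  S≈ : S ≈ₛ numerator Xₛ Yₛ PS.- denominator Xₛ ⋆ (Yₛ ⋆ u 0)
  S≈ = -ₛ-cong Pnum≈numerator (*ₛ-cong Den≈denominator BWA≈Yₛ⋆u₀)

  S²≡Qrad : ∀ n k → (S *ₛ S) n k ≡ Qrad n k
  S²≡Qrad = PS.trans (*ₛ-cong S≈ S≈) (PS.trans (discriminant stateRecurrences u₁-factorizes) (PS.sym Qrad≈radicand))

  d≡p-[p-d] : ∀ p d → d ≡ p ℤ.- (p ℤ.- d)
  d≡p-[p-d] = ℤ-Solver.solve-∀
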